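{- For each nonnegative integer $n$ and generalized ordered sets $X_0,\dots,X_n$, the cartesian product $\prod_{i=0}^nX_i$ with the lexicographic order is a generalized ordered set.
   Context: The setting is constructive mathematics: no use of the law of excluded middle. For a set $X$ with a binary relation $<$, write $x\leq_{P}y$ if for all $z\in X$, $z<x$ implies $z<y$, and $y<z$ implies $x<z$. A generalized ordered set is a set $X$ with a binary relation $<$ such that for all $x,y,z\in X$: (asymmetry) $x<y$ implies $\neg(y<x)$; (transitivity) $x<y$ and $y<z$ imply $x<z$; (positive antisymmetry) $x\leq_{P}y$ and $y\leq_{P}x$ imply $x=y$. The product $\prod_{i=0}^nX_i$ has componentwise equality. Its lexicographic order is $(x_0,\dots,x_n)<(y_0,\dots,y_n)$ iff there is $k\in\{0,\dots,n\}$ with $x_k<y_k$ and $x_j=y_j$ for all $j<k$. -}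

module Defs where

open import Level using (Level; _⊔_) renaming (suc to lsuc)
open import Data.Nat using (ℕ; suc)
open import Data.Fin using (Fin) renaming (_<_ to _<ᶠ_)
open import Data.Product using (∃; _×_; _,_)
open import Relation.Nullary using (¬_)
open import Relation.Binary.Structures using (IsEquivalence)

module _ {c r : Level} {A : Set c} (_<_ : A → A → Set r) where
  _≤[_]P_ : A → A → Set (c ⊔ r)
  _≤[_]P_ x y = ∀ z → (z < x → z < y) × (y < z → x < z)

-- A set in the sense of constructive (Bishop-style) mathematics is a type with
-- an equality relation (an equivalence relation); binary relations on it are
-- required to respect that equality.
record IsGenOrd {c ℓ r : Level} {A : Set c}
                (_≈_ : A → A → Set ℓ) (_<_ : A → A → Set r) : Set (c ⊔ ℓ ⊔ r) where
  field
    isEquiv     : IsEquivalence _≈_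
    <-resp-≈    : ∀ {x x′ y y′} → x ≈ x′ → y ≈ y′ → x < y → x′ < y′
    asym        : ∀ {x y} → x < y → ¬ (y < x)
    trans       : ∀ {x y z} → x < y → y < z → x < z
    pos-antisym : ∀ {x y} → _≤[_]P_ _<_ x y → _≤[_]P_ _<_ y x → x ≈ y

record GenOrdSet (c ℓ r : Level) : Set (lsuc (c ⊔ ℓ ⊔ r)) where
  field
    Carrier  : Set c
    _≈_      : Carrier → Carrier → Set ℓ
    _<_      : Carrier → Carrier → Set r
    isGenOrd : IsGenOrd _≈_ _<_

module _ {c ℓ r : Level} (n : ℕ) (X : Fin (suc n) → GenOrdSet c ℓ r) where
  open GenOrdSet

  ProdCarrier : Set c
  ProdCarrier = (i : Fin (suc n)) → Carrier (X i)

  ProdEq : ProdCarrier → ProdCarrier → Set ℓ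
  ProdEq x y = ∀ i → _≈_ (X i) (x i) (y i)

  LexLt : ProdCarrier → ProdCarrier → Set (ℓ ⊔ r)
  LexLt x y = ∃ λ (k : Fin (suc n)) →
                _<_ (X k) (x k) (y k) × (∀ (j : Fin (suc n)) → j <ᶠ k → _≈_ (X j) (x j) (y j))

module Submission where

-- Everything but positive antisymmetry is checked by comparing the witnessing
-- indices of two lexicographic inequalities. For positive antisymmetry, assume
-- x ≤P y and y ≤P x in the product and show x i ≈ y i by well-founded induction
-- on i, so that x and y agree before i. If a < x i, then the tuple obtained from
-- x by replacing its i-th coordinate with a lies below x, hence below y; as it
-- agrees with y before i, either a < y i or a ≈ y i, and the latter would give
-- y i < x i and so y < x, which x ≤P y forbids. The dual argument and
-- positive antisymmetry in X i then give x i ≈ y i.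

open import Defs
open import Level using (Level; _⊔_)
open import Data.Nat using (ℕ; suc)
open import Data.Fin using (Fin; _≟_) renaming (_<_ to _<ᶠ_)
open import Data.Fin.Properties using (<-cmp; <-trans; <⇒≢)
open import Data.Fin.Induction using (<-wellFounded)
open import Data.Product using (_,_; proj₁; proj₂)
open import Data.Sum using (_⊎_; inj₁; inj₂)
open import Data.Empty using (⊥-elim)
open import Induction.WellFounded using (module All)
open import Relation.Nullary using (¬_; yes; no)
open import Relation.Binary.Core using (Rel)
open import Relation.Binary.Definitions using (Asymmetric; tri<; tri≈; tri>)
open import Relation.Binary.Structures using (IsEquivalence)
open import Relation.Binary.PropositionalEquality using (_≡_; refl)

module _ {a r : Level} {A : Set a} {_<_ : Rel A r} where

  ≤P⇒≯ : Asymmetric _<_ → ∀ {x y} → _≤[_]P_ _<_ x y → ¬ (y < x)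
  ≤P⇒≯ asym {x} {y} x≤y y<x = asym y<y y<y
    where
    y<y : y < y
    y<y = proj₁ (x≤y y) y<x

module Lexicographic {c ℓ r : Level} (n : ℕ) (X : Fin (suc n) → GenOrdSet c ℓ r) where
  open GenOrdSet using (Carrier; _≈_; _<_)

  private
    Index : Set
    Index = Fin (suc n)

    Tuple : Set c
    Tuple = ProdCarrier n X

    module X (i : Index) = IsGenOrd (GenOrdSet.isGenOrd (X i))
    module ≈ (i : Index) = IsEquivalence (X.isEquiv i)

  _≈ₚ_ : Rel Tuple ℓ
  _≈ₚ_ = ProdEq n X

  _<ₗ_ : Rel Tuple (ℓ ⊔ r)
  _<ₗ_ = LexLt n X

  <-irrefl : ∀ i {a} → ¬ _<_ (X i) a a
  <-irrefl i a<a = X.asym i a<a a<a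

  Agree : Tuple → Tuple → Index → Set ℓ
  Agree x y k = ∀ j → j <ᶠ k → _≈_ (X j) (x j) (y j)

  Agree-sym : ∀ {x y k} → Agree x y k → Agree y x k
  Agree-sym x~y j j<k = ≈.sym j (x~y j j<k)

  Agree-trans : ∀ {x y z k} → Agree x y k → Agree y z k → Agree x z k
  Agree-trans x~y y~z j j<k = ≈.trans j (x~y j j<k) (y~z j j<k)

  Agree-< : ∀ {x y k l} → l <ᶠ k → Agree x y k → Agree x y l
  Agree-< l<k x~y j j<l = x~y j (<-trans j<l l<k)

  ≈ₚ-isEquivalence : IsEquivalence _≈ₚ_
  ≈ₚ-isEquivalence = record
    { refl  = λ i → ≈.refl i
    ; sym   = λ x≈y i → ≈.sym i (x≈y i)
    ; trans = λ x≈y y≈z i → ≈.trans i (x≈y i) (y≈z i)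
    }

  <ₗ-resp-≈ₚ : ∀ {x x′ y y′} → x ≈ₚ x′ → y ≈ₚ y′ → x <ₗ y → x′ <ₗ y′
  <ₗ-resp-≈ₚ x≈x′ y≈y′ (k , x<y , x~y) =
    k , X.<-resp-≈ k (x≈x′ k) (y≈y′ k) x<y ,
    λ j j<k → ≈.trans j (≈.sym j (x≈x′ j)) (≈.trans j (x~y j j<k) (y≈y′ j))

  <ₗ-irrefl : ∀ {x} → ¬ (x <ₗ x)
  <ₗ-irrefl (k , x<x , _) = <-irrefl k x<x

  <ₗ-trans : ∀ {x y z} → x <ₗ y → y <ₗ z → x <ₗ z
  <ₗ-trans (k , x<y , x~y) (l , y<z , y~z) with <-cmp k l
  ... | tri< k<l _ _ = k , X.<-resp-≈ k (≈.refl k) (y~z k k<l) x<y ,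
                       Agree-trans x~y (Agree-< k<l y~z)
  ... | tri≈ _ refl _ = k , X.trans k x<y y<z , Agree-trans x~y y~z
  ... | tri> _ _ l<k = l , X.<-resp-≈ l (≈.sym l (x~y l l<k)) (≈.refl l) y<z ,
                       Agree-trans (Agree-< l<k x~y) y~z

  <ₗ-asym : Asymmetric _<ₗ_
  <ₗ-asym x<y y<x = <ₗ-irrefl (<ₗ-trans x<y y<x)

  <ₗ⇒<⊎≈-at : ∀ {x y} i → x <ₗ y → Agree x y i →
          _<_ (X i) (x i) (y i) ⊎ _≈_ (X i) (x i) (y i)
  <ₗ⇒<⊎≈-at i (k , x<y , x~yₖ) x~yᵢ with <-cmp k i
  ... | tri< k<i _ _ = ⊥-elim (<-irrefl k (X.<-resp-≈ k (x~yᵢ k k<i) (≈.refl k) x<y))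
  ... | tri≈ _ refl _ = inj₁ x<y
  ... | tri> _ _ i<k = inj₂ (x~yₖ i i<k)

  update : Tuple → (i : Index) → Carrier (X i) → Tuple
  update x i a j with j ≟ i
  ... | yes refl = a
  ... | no _     = x j

  update-≈ : ∀ x i a → _≈_ (X i) (update x i a i) a
  update-≈ x i a with i ≟ i
  ... | yes refl = ≈.refl i
  ... | no i≢i   = ⊥-elim (i≢i refl)

  update-≢ : ∀ x i a j → ¬ j ≡ i → update x i a j ≡ x j
  update-≢ x i a j j≢i with j ≟ i
  ... | yes j≡i = ⊥-elim (j≢i j≡i)
  ... | no _    = refl

  update-Agree : ∀ x i a → Agree (update x i a) x i
  update-Agree x i a j j<i = ≈.reflexive j (update-≢ x i a j (<⇒≢ j<i))

  update-<ₗ : ∀ {x i a} → _<_ (X i) a (x i) → update x i a <ₗ x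
  update-<ₗ {x} {i} {a} a<xᵢ =
    i , X.<-resp-≈ i (≈.sym i (update-≈ x i a)) (≈.refl i) a<xᵢ , update-Agree x i a

  <ₗ-update : ∀ {x i a} → _<_ (X i) (x i) a → x <ₗ update x i a
  <ₗ-update {x} {i} {a} xᵢ<a =
    i , X.<-resp-≈ i (≈.refl i) (≈.sym i (update-≈ x i a)) xᵢ<a ,
    Agree-sym (update-Agree x i a)

  _≤ₗ_ : Rel Tuple (c ⊔ ℓ ⊔ r)
  _≤ₗ_ = _≤[_]P_ _<ₗ_

  ≤ₗ⇒≯-at : ∀ {x y} i → x ≤ₗ y → Agree x y i → ¬ _<_ (X i) (y i) (x i)
  ≤ₗ⇒≯-at i x≤y x~y yᵢ<xᵢ = ≤P⇒≯ {_<_ = _<ₗ_} <ₗ-asym x≤y (i , yᵢ<xᵢ , Agree-sym x~y)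

  ≤ₗ⇒≤P-at : ∀ {x y} i → x ≤ₗ y → Agree x y i → _≤[_]P_ (_<_ (X i)) (x i) (y i)
  ≤ₗ⇒≤P-at {x} {y} i x≤y x~y a = below , above
    where
    below : _<_ (X i) a (x i) → _<_ (X i) a (y i)
    below a<xᵢ with <ₗ⇒<⊎≈-at i (proj₁ (x≤y _) (update-<ₗ a<xᵢ))
                            (Agree-trans (update-Agree x i a) x~y)
    ... | inj₁ a<yᵢ = X.<-resp-≈ i (update-≈ x i a) (≈.refl i) a<yᵢ
    ... | inj₂ a≈yᵢ = ⊥-elim (≤ₗ⇒≯-at i x≤y x~y
            (X.<-resp-≈ i (≈.trans i (≈.sym i (update-≈ x i a)) a≈yᵢ) (≈.refl i) a<xᵢ))

    above : _<_ (X i) (y i) a → _<_ (X i) (x i) a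
    above yᵢ<a with <ₗ⇒<⊎≈-at i (proj₂ (x≤y _) (<ₗ-update yᵢ<a))
                            (Agree-trans x~y (Agree-sym (update-Agree y i a)))
    ... | inj₁ xᵢ<a = X.<-resp-≈ i (≈.refl i) (update-≈ y i a) xᵢ<a
    ... | inj₂ xᵢ≈a = ⊥-elim (≤ₗ⇒≯-at i x≤y x~y
            (X.<-resp-≈ i (≈.refl i) (≈.sym i (≈.trans i xᵢ≈a (update-≈ y i a))) yᵢ<a))

  <ₗ-pos-antisym : ∀ {x y} → x ≤ₗ y → y ≤ₗ x → x ≈ₚ y
  <ₗ-pos-antisym {x} {y} x≤y y≤x =
    All.wfRec <-wellFounded ℓ (λ i → _≈_ (X i) (x i) (y i)) step
    where
    step : ∀ i → (∀ {j} → j <ᶠ i → _≈_ (X j) (x j) (y j)) → _≈_ (X i) (x i) (y i)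
    step i ih = X.pos-antisym i (≤ₗ⇒≤P-at i x≤y x~y) (≤ₗ⇒≤P-at i y≤x (Agree-sym x~y))
      where
      x~y : Agree x y i
      x~y j j<i = ih j<i

  isGenOrd : IsGenOrd _≈ₚ_ _<ₗ_
  isGenOrd = record
    { isEquiv     = ≈ₚ-isEquivalence
    ; <-resp-≈    = <ₗ-resp-≈ₚ
    ; asym        = <ₗ-asym
    ; trans       = <ₗ-trans
    ; pos-antisym = <ₗ-pos-antisym
    }

theorem20 : {c ℓ r : Level} (n : ℕ) (X : Fin (suc n) → GenOrdSet c ℓ r) →
    IsGenOrd (ProdEq n X) (LexLt n X)
theorem20 n X = Lexicographic.isGenOrd n X
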